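{- Let $a$ be an indeterminate. For every nonnegative integer $n$, $$\sum_{\lambda \in Q(n)} \omega_e(\lambda) = \begin{cases} (-a)^k, & \text{if } n = k^2 \text{ for some nonnegative integer } k,\\ 0, & \text{otherwise,}\end{cases}$$ where for $\lambda = (\lambda_1, \ldots, \lambda_l) \in Q(n)$ the weight is $\omega_e(\lambda) = (-1)^{l-1} a^{\ell_o(\lambda)}$.
   Context: $Q(n)$ denotes the set of nonempty finite strictly decreasing sequences $\lambda = (\lambda_1 > \lambda_2 > \cdots > \lambda_l)$ of nonnegative integers (so $0$ is allowed as a part, at most once) with $\lambda_1 + \cdots + \lambda_l = n$ and whose smallest part $\lambda_l$ is even. Here $l$ is the number of parts of $\lambda$ (a part equal to $0$ counts as a part), and $\ell_o(\lambda)$ is the number of odd parts of $\lambda$. -}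

module Defs where

open import Level using (0ℓ)
open import Data.Bool using (Bool; true; false; _∧_)
open import Data.Nat using (ℕ; zero; suc; _>_; _>?_; _≡ᵇ_; _∸_)
open import Data.Nat.Divisibility using (_∣?_)
open import Data.Maybe using (Maybe; just; nothing)
open import Data.Nat.ListAction using (sum)
open import Data.List using (List; []; _∷_; _++_; map; length; filterᵇ; foldr; last)
open import Data.List.Relation.Unary.Linked using (linked?)
open import Relation.Nullary.Decidable using (⌊_⌋)
open import Algebra.Bundles using (CommutativeRing)

subsetsDesc : ℕ → List (List ℕ)
subsetsDesc zero    = [] ∷ []
subsetsDesc (suc m) = subsetsDesc m ++ map (m ∷_) (subsetsDesc m)

nonempty : List ℕ → Bool
nonempty []      = false
nonempty (_ ∷ _) = true

strictlyDecreasing : List ℕ → Bool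
strictlyDecreasing xs = ⌊ linked? _>?_ xs ⌋

lastEven : List ℕ → Bool
lastEven xs with last xs
... | nothing = false
... | just x  = ⌊ 2 ∣? x ⌋

isQ : ℕ → List ℕ → Bool
isQ n xs = nonempty xs ∧ strictlyDecreasing xs ∧ (sum xs ≡ᵇ n) ∧ lastEven xs

-- Q(n) as a finite list: every element of Q(n) has distinct parts in {0,...,n},
-- hence occurs (exactly once) among subsetsDesc (suc n).
Q : ℕ → List (List ℕ)
Q n = filterᵇ (isQ n) (subsetsDesc (suc n))

oddParts : List ℕ → ℕ
oddParts []       = 0
oddParts (x ∷ xs) with ⌊ 2 ∣? x ⌋
... | true  = oddParts xs
... | false = suc (oddParts xs)

module _ (R : CommutativeRing 0ℓ 0ℓ) where
  open CommutativeRing R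

  pow : Carrier → ℕ → Carrier
  pow x zero    = 1#
  pow x (suc k) = x * pow x k

  -- ω_e(λ) = (-1)^(l-1) a^(ℓ_o(λ)), l = number of parts (a 0 part counts)
  ωe : Carrier → List ℕ → Carrier
  ωe a xs = pow (- 1#) (length xs ∸ 1) * pow a (oddParts xs)

  sumR : List Carrier → Carrier
  sumR = foldr _+_ 0#

  sumQ : Carrier → ℕ → Carrier
  sumQ a n = sumR (map (ωe a) (Q n))

-- Grouping the members of Q(n) by their smallest part i (which is even), the generating
-- function of ω_e is Σ_{i even} q^i ∏_{x > i} (1 - w_x q^x) with w_x = 1 for even x and
-- w_x = a for odd x. This is G 0 for the family
--   G r = Σ_j q^(2j) ∏_{odd x ≥ 2(r+j)+1} (1 - a q^x) ∏_{even x ≥ 2j+2} (1 - q^x).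
-- Splitting single factors off these products makes G r + a q^(2r+1) G (r+1) telescope
-- to 1, and that recurrence forces G r = Σ_k (-a)^k q^(k² + 2rk).
-- Power series are their coefficient functions ℕ → R; infinite products are read
-- coefficientwise, since factors (1 - w_x q^x) with x > n do not affect the coefficient of q^n.

module Submission where

open import Defs
open import Level using (0ℓ)
open import Algebra.Bundles using (CommutativeRing)
open import Data.Bool using (Bool; true; false; not; if_then_else_; _∧_)
open import Data.Bool.Properties using (T-≡; ¬-not; not-¬; ∧-zeroʳ)
open import Data.Empty using (⊥-elim)
open import Data.List using (List; []; _∷_; _++_; map; length; downFrom; filterᵇ; null)
open import Data.List.Properties using (map-∘)
open import Data.List.Relation.Unary.All as All using (All; []; _∷_)
import Data.List.Relation.Unary.All.Properties as All
open import Data.Nat using (ℕ; zero; suc; _+_; _*_; _≤_; _<_; _<?_; _>?_; _≤ᵇ_; _<ᵇ_; _≡ᵇ_; z≤n; s≤s)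
open import Data.Nat.ListAction using (sum)
import Data.Nat.Properties as ℕ
open import Data.Nat.Divisibility using (_∣?_)
open import Data.Nat.Induction using (<-rec)
open import Data.Nat.Tactic.RingSolver using (solve-∀)
open import Data.Product using (_×_; _,_)
open import Data.Sum using (inj₁; inj₂)
open import Function using (id; _∘_; Equivalence)
open import Relation.Binary.PropositionalEquality as ≡ using (_≡_; _≢_)
open import Relation.Nullary using (yes; no)
open import Relation.Nullary.Decidable using (does; isYes≗does)

even : ℕ → Bool
even x = does (2 ∣? x)

even-suc : ∀ x → even (suc x) ≡ not (even x)
even-suc zero          = ≡.refl
even-suc (suc zero)    = ≡.refl
even-suc (suc (suc x)) = even-suc x

even-double : ∀ j → even (2 * j) ≡ true
even-double zero    = ≡.refl
even-double (suc j) = ≡.trans (≡.cong even (ℕ.*-suc 2 j)) (even-double j)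

even-double+1 : ∀ j → even (suc (2 * j)) ≡ false
even-double+1 j = ≡.trans (even-suc (2 * j)) (≡.cong not (even-double j))

suc≢-of-same-parity : ∀ x y → even x ≡ even y → suc x ≢ y
suc≢-of-same-parity x _ ex≡ey ≡.refl = not-¬ ≡.refl (≡.trans ex≡ey (even-suc x))

≤ᵇ-true : ∀ {m n} → m ≤ n → (m ≤ᵇ n) ≡ true
≤ᵇ-true = Equivalence.to T-≡ ∘ ℕ.≤⇒≤ᵇ

≤ᵇ-false : ∀ {m n} → n < m → (m ≤ᵇ n) ≡ false
≤ᵇ-false {m} {n} n<m = ¬-not (λ m≤ᵇn → ℕ.<⇒≱ n<m (ℕ.≤ᵇ⇒≤ m n (Equivalence.from T-≡ m≤ᵇn)))

≤ᵇ-skip : ∀ o y → o ≢ y → (o ≤ᵇ y) ≡ (suc o ≤ᵇ y)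
≤ᵇ-skip zero          zero    o≢y = ⊥-elim (o≢y ≡.refl)
≤ᵇ-skip zero          (suc y) _   = ≡.refl
≤ᵇ-skip (suc o)       zero    _   = ≡.refl
≤ᵇ-skip (suc zero)    (suc y) o≢y = ≤ᵇ-skip zero y (o≢y ∘ ≡.cong suc)
≤ᵇ-skip (suc (suc o)) (suc y) o≢y = ≤ᵇ-skip (suc o) y (o≢y ∘ ≡.cong suc)

≡ᵇ-cancelˡ : ∀ k s m → (k + s ≡ᵇ k + m) ≡ (s ≡ᵇ m)
≡ᵇ-cancelˡ zero    s m = ≡.refl
≡ᵇ-cancelˡ (suc k) s m = ≡ᵇ-cancelˡ k s m

≡ᵇ-below : ∀ k s {n} → n < k → (k + s ≡ᵇ n) ≡ false
≡ᵇ-below (suc k) s {zero}  _         = ≡.refl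
≡ᵇ-below (suc k) s {suc n} (s≤s n<k) = ≡ᵇ-below k s n<k

square-step : ∀ k r → suc k * suc k + 2 * r * suc k ≡ suc (2 * r) + (k * k + 2 * suc r * k)
square-step = solve-∀

module Series (R : CommutativeRing 0ℓ 0ℓ) where
  open CommutativeRing R renaming (_+_ to _⊕_; _*_ to _⊗_; -_ to ⊖_; _-_ to _⊝_)
  open import Algebra.Properties.Ring ring
    using (-0#≈0#; -‿distribˡ-*; x[y-z]≈xy-xz; //-rightDividesˡ; //-rightDividesʳ; ⁻¹-anti-homo‿-)
  open import Algebra.Properties.CommutativeSemigroup +-commutativeSemigroup
    using (interchange) renaming (x∙yz≈y∙xz to x⊕yz≈y⊕xz)
  open import Algebra.Properties.CommutativeSemigroup *-commutativeSemigroup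
    using () renaming (x∙yz≈y∙xz to x⊗yz≈y⊗xz)
  open import Relation.Binary.Reasoning.Setoid setoid

  x⊝y⊗0≈x : ∀ x y → x ⊝ y ⊗ 0# ≈ x
  x⊝y⊗0≈x x y = begin
    x ⊝ y ⊗ 0#  ≈⟨ +-congˡ (-‿cong (zeroʳ y)) ⟩
    x ⊝ 0#      ≈⟨ +-congˡ -0#≈0# ⟩
    x ⊕ 0#      ≈⟨ +-identityʳ x ⟩
    x           ∎

  Series : Set
  Series = ℕ → Carrier

  infix 4 _≋_
  _≋_ : Series → Series → Set
  f ≋ g = ∀ n → f n ≈ g n

  one : Series
  one zero    = 1#
  one (suc _) = 0#

  infixr 9 q^_·_
  q^_·_ : ℕ → Series → Series
  (q^ zero  · f) n       = f n
  (q^ suc k · f) zero    = 0#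
  (q^ suc k · f) (suc n) = (q^ k · f) n

  q^-cong-≤ : ∀ k {f g} n → (∀ m → m ≤ n → f m ≈ g m) → (q^ k · f) n ≈ (q^ k · g) n
  q^-cong-≤ zero    n       f≈g = f≈g n ℕ.≤-refl
  q^-cong-≤ (suc k) zero    f≈g = refl
  q^-cong-≤ (suc k) (suc n) f≈g = q^-cong-≤ k n (λ m m≤n → f≈g m (ℕ.m≤n⇒m≤1+n m≤n))

  q^-cong : ∀ k {f g} → f ≋ g → q^ k · f ≋ q^ k · g
  q^-cong k f≋g n = q^-cong-≤ k n (λ m _ → f≋g m)

  q^-below : ∀ k f {n} → n < k → (q^ k · f) n ≡ 0#
  q^-below (suc k) f {zero}  _          = ≡.refl
  q^-below (suc k) f {suc n} (s≤s n<k) = q^-below k f n<k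

  q^-+ : ∀ k f m → (q^ k · f) (k + m) ≡ f m
  q^-+ zero    f m = ≡.refl
  q^-+ (suc k) f m = q^-+ k f m

  q^-q^ : ∀ i j f n → (q^ i · q^ j · f) n ≡ (q^ (i + j) · f) n
  q^-q^ zero    j f n       = ≡.refl
  q^-q^ (suc i) j f zero    = ≡.refl
  q^-q^ (suc i) j f (suc n) = q^-q^ i j f n

  q^-comm : ∀ i j f → q^ i · q^ j · f ≋ q^ j · q^ i · f
  q^-comm i j f n = reflexive (≡.trans (q^-q^ i j f n)
    (≡.trans (≡.cong (λ k → (q^ k · f) n) (ℕ.+-comm i j)) (≡.sym (q^-q^ j i f n))))

  q^-zero : ∀ k n → (q^ k · (λ _ → 0#)) n ≡ 0#
  q^-zero zero    n       = ≡.refl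
  q^-zero (suc k) zero    = ≡.refl
  q^-zero (suc k) (suc n) = q^-zero k n

  q^-one : ∀ k n → (q^ k · one) n ≡ (if k ≡ᵇ n then 1# else 0#)
  q^-one zero    zero    = ≡.refl
  q^-one zero    (suc n) = ≡.refl
  q^-one (suc k) zero    = ≡.refl
  q^-one (suc k) (suc n) = q^-one k n

  q^-linear : ∀ k f c g n → (q^ k · (λ m → f m ⊝ c ⊗ g m)) n ≈ (q^ k · f) n ⊝ c ⊗ (q^ k · g) n
  q^-linear zero    f c g n       = refl
  q^-linear (suc k) f c g zero    = sym (x⊝y⊗0≈x 0# c)
  q^-linear (suc k) f c g (suc n) = q^-linear k f c g n

  ∑ : {A : Set} → List A → (A → Carrier) → Carrier
  ∑ xs f = sumR R (map f xs)

  module _ {A : Set} where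

    ∑-++ : ∀ (xs ys : List A) f → ∑ (xs ++ ys) f ≈ ∑ xs f ⊕ ∑ ys f
    ∑-++ []       ys f = sym (+-identityˡ _)
    ∑-++ (x ∷ xs) ys f = trans (+-congˡ (∑-++ xs ys f)) (sym (+-assoc _ _ _))

    ∑-map : ∀ {B : Set} (g : B → A) xs f → ∑ (map g xs) f ≡ ∑ xs (f ∘ g)
    ∑-map g xs f = ≡.cong (sumR R) (≡.sym (map-∘ xs))

    ∑-cong : ∀ {f g} (xs : List A) → (∀ x → f x ≈ g x) → ∑ xs f ≈ ∑ xs g
    ∑-cong []       f≈g = refl
    ∑-cong (x ∷ xs) f≈g = +-cong (f≈g x) (∑-cong xs f≈g)

    ∑-cong-All : ∀ {P : A → Set} {f g} xs → All P xs → (∀ {x} → P x → f x ≈ g x) → ∑ xs f ≈ ∑ xs g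
    ∑-cong-All []       []         f≈g = refl
    ∑-cong-All (x ∷ xs) (px ∷ pxs) f≈g = +-cong (f≈g px) (∑-cong-All xs pxs f≈g)

    ∑-zero : ∀ (xs : List A) → ∑ xs (λ _ → 0#) ≈ 0#
    ∑-zero []       = refl
    ∑-zero (x ∷ xs) = trans (+-identityˡ _) (∑-zero xs)

    ∑-+ : ∀ (xs : List A) f g → ∑ xs (λ x → f x ⊕ g x) ≈ ∑ xs f ⊕ ∑ xs g
    ∑-+ []       f g = sym (+-identityʳ 0#)
    ∑-+ (x ∷ xs) f g = trans (+-congˡ (∑-+ xs f g)) (interchange _ _ _ _)

    ∑-⊗ : ∀ (xs : List A) c f → ∑ xs (λ x → c ⊗ f x) ≈ c ⊗ ∑ xs f
    ∑-⊗ []       c f = sym (zeroʳ c)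
    ∑-⊗ (x ∷ xs) c f = trans (+-congˡ (∑-⊗ xs c f)) (sym (distribˡ c _ _))

    ∑-linear : ∀ (xs : List A) f c g → ∑ xs (λ x → f x ⊝ c ⊗ g x) ≈ ∑ xs f ⊝ c ⊗ ∑ xs g
    ∑-linear xs f c g = begin
      ∑ xs (λ x → f x ⊝ c ⊗ g x)        ≈⟨ ∑-+ xs f _ ⟩
      ∑ xs f ⊕ ∑ xs (λ x → ⊖ (c ⊗ g x)) ≈⟨ +-congˡ (∑-cong xs (λ x → -‿distribˡ-* c (g x))) ⟩
      ∑ xs f ⊕ ∑ xs (λ x → ⊖ c ⊗ g x)   ≈⟨ +-congˡ (∑-⊗ xs (⊖ c) g) ⟩
      ∑ xs f ⊕ ⊖ c ⊗ ∑ xs g             ≈⟨ +-congˡ (sym (-‿distribˡ-* c _)) ⟩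
      ∑ xs f ⊝ c ⊗ ∑ xs g               ∎

  q^-∑ : ∀ {A : Set} k (xs : List A) (F : A → Series) n →
         (q^ k · (λ m → ∑ xs (λ x → F x m))) n ≈ ∑ xs (λ x → (q^ k · F x) n)
  q^-∑ zero    xs F n       = refl
  q^-∑ (suc k) xs F zero    = sym (∑-zero xs)
  q^-∑ (suc k) xs F (suc n) = q^-∑ k xs F n

  ∑-filter : ∀ {A : Set} p (xs : List A) f → ∑ (filterᵇ p xs) f ≈ ∑ xs (λ x → if p x then f x else 0#)
  ∑-filter p []       f = refl
  ∑-filter p (x ∷ xs) f with p x
  ... | true  = +-congˡ (∑-filter p xs f)
  ... | false = trans (∑-filter p xs f) (sym (+-identityˡ _))

  ∑-downFrom-cong : ∀ J {f g} → (∀ j → j < J → f j ≈ g j) → ∑ (downFrom J) f ≈ ∑ (downFrom J) g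
  ∑-downFrom-cong J f≈g = ∑-cong-All (downFrom J) (All.applyDownFrom⁺₁ id J id) (λ {j} → f≈g j)

  ∑-downFrom-truncate : ∀ {K} J f → (∀ j → K ≤ j → f j ≈ 0#) → K ≤ J →
                        ∑ (downFrom J) f ≈ ∑ (downFrom K) f
  ∑-downFrom-truncate zero    f f≈0 z≤n = refl
  ∑-downFrom-truncate (suc J) f f≈0 K≤1+J with ℕ.m≤n⇒m<n∨m≡n K≤1+J
  ... | inj₂ ≡.refl = refl
  ... | inj₁ K<1+J  = trans (+-cong (f≈0 J (ℕ.≤-pred K<1+J)) (∑-downFrom-truncate J f f≈0 (ℕ.≤-pred K<1+J)))
                            (+-identityˡ _)

  ∑-downFrom-evens : ∀ K f → (∀ j → f (suc (2 * j)) ≈ 0#) →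
                     ∑ (downFrom (2 * K)) f ≈ ∑ (downFrom K) (λ j → f (2 * j))
  ∑-downFrom-evens zero    f odd≈0 = refl
  ∑-downFrom-evens (suc K) f odd≈0 =
    trans (reflexive (≡.cong (λ J → ∑ (downFrom J) f) (ℕ.*-suc 2 K)))
          (trans (+-cong (odd≈0 K) (+-congˡ (∑-downFrom-evens K f odd≈0))) (+-identityˡ _))

  ∑-telescope : ∀ (t p : ℕ → Carrier) → t 0 ≈ p 0 → (∀ j → t (suc j) ≈ p (suc j) ⊝ p j) →
                ∀ J → ∑ (downFrom (suc J)) t ≈ p J
  ∑-telescope t p t₀ tₛ zero    = trans (+-identityʳ _) t₀
  ∑-telescope t p t₀ tₛ (suc J) =
    trans (+-cong (tₛ J) (∑-telescope t p t₀ tₛ J)) (//-rightDividesˡ (p J) (p (suc J)))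

  module Product (c : ℕ → Carrier) where

    factor : ℕ → Series → Series
    factor x f n = f n ⊝ c x ⊗ (q^ x · f) n

    factor-cong-≤ : ∀ x {f g} n → (∀ m → m ≤ n → f m ≈ g m) → factor x f n ≈ factor x g n
    factor-cong-≤ x n f≈g = +-cong (f≈g n ℕ.≤-refl) (-‿cong (*-congˡ (q^-cong-≤ x n f≈g)))

    factor-cong : ∀ x {f g} → f ≋ g → factor x f ≋ factor x g
    factor-cong x f≋g n = factor-cong-≤ x n (λ m _ → f≋g m)

    factor-below : ∀ x f {n} → n < x → factor x f n ≈ f n
    factor-below x f n<x = trans (+-congˡ (-‿cong (*-congˡ (reflexive (q^-below x f n<x))))) (x⊝y⊗0≈x _ _)

    factor-zero : ∀ x n → factor x (λ _ → 0#) n ≈ 0#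
    factor-zero x n = trans (+-congˡ (-‿cong (*-congˡ (reflexive (q^-zero x n))))) (x⊝y⊗0≈x _ _)

    factor-complement : ∀ x f n → factor x f n ⊕ c x ⊗ (q^ x · f) n ≈ f n
    factor-complement x f n = //-rightDividesˡ _ _

    factor²-complement : ∀ x y f n →
      c y ⊗ (q^ y · factor x f) n ⊕ c x ⊗ (q^ x · f) n ≈ f n ⊝ factor y (factor x f) n
    factor²-complement x y f n = sym (begin
      f n ⊝ ((f n ⊝ X) ⊝ Y)      ≈⟨ +-congˡ (⁻¹-anti-homo‿- (f n ⊝ X) Y) ⟩
      f n ⊕ (Y ⊝ (f n ⊝ X))      ≈⟨ +-congˡ (+-congˡ (⁻¹-anti-homo‿- (f n) X)) ⟩
      f n ⊕ (Y ⊕ (X ⊝ f n))      ≈⟨ x⊕yz≈y⊕xz (f n) Y _ ⟩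
      Y ⊕ (f n ⊕ (X ⊝ f n))      ≈⟨ +-congˡ (trans (+-comm (f n) _) (//-rightDividesˡ (f n) X)) ⟩
      Y ⊕ X                      ∎)
      where
      X = c x ⊗ (q^ x · f) n
      Y = c y ⊗ (q^ y · factor x f) n

    q^-factor : ∀ k x f → q^ k · factor x f ≋ factor x (q^ k · f)
    q^-factor k x f n =
      trans (q^-linear k f (c x) (q^ x · f) n) (+-congˡ (-‿cong (*-congˡ (q^-comm k x f n))))

    factor-comm : ∀ x y f → factor x (factor y f) ≋ factor y (factor x f)
    factor-comm x y f n = begin
      (F ⊝ c y ⊗ Y) ⊝ c x ⊗ (q^ x · factor y f) n      ≈⟨ +-congˡ (-‿cong (*-congˡ (q^-factor x y f n))) ⟩
      (F ⊝ c y ⊗ Y) ⊝ c x ⊗ (X ⊝ c y ⊗ (q^ y · q^ x · f) n)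
        ≈⟨ +-congˡ (-‿cong (*-congˡ (+-congˡ (-‿cong (*-congˡ (q^-comm y x f n)))))) ⟩
      (F ⊝ c y ⊗ Y) ⊝ c x ⊗ (X ⊝ c y ⊗ XY)              ≈⟨ swap (c y) (c x) ⟩
      (F ⊝ c x ⊗ X) ⊝ c y ⊗ (Y ⊝ c x ⊗ XY)              ≈⟨ +-congˡ (-‿cong (*-congˡ (q^-factor y x f n))) ⟨
      (F ⊝ c x ⊗ X) ⊝ c y ⊗ (q^ y · factor x f) n      ∎
      where
      F  = f n
      X  = (q^ x · f) n
      Y  = (q^ y · f) n
      XY = (q^ x · q^ y · f) n
      swap : ∀ u v → (F ⊝ u ⊗ Y) ⊝ v ⊗ (X ⊝ u ⊗ XY) ≈ (F ⊝ v ⊗ X) ⊝ u ⊗ (Y ⊝ v ⊗ XY)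
      swap u v = begin
        (F ⊝ u ⊗ Y) ⊝ v ⊗ (X ⊝ u ⊗ XY)              ≈⟨ +-congˡ (-‿cong (x[y-z]≈xy-xz v X _)) ⟩
        (F ⊝ u ⊗ Y) ⊕ ⊖ (v ⊗ X ⊝ v ⊗ (u ⊗ XY))      ≈⟨ +-congˡ (⁻¹-anti-homo‿- _ _) ⟩
        (F ⊝ u ⊗ Y) ⊕ (v ⊗ (u ⊗ XY) ⊝ v ⊗ X)        ≈⟨ +-congˡ (+-congʳ (x⊗yz≈y⊗xz v u XY)) ⟩
        (F ⊝ u ⊗ Y) ⊕ (u ⊗ (v ⊗ XY) ⊝ v ⊗ X)        ≈⟨ +-congˡ (+-comm _ _) ⟩
        (F ⊝ u ⊗ Y) ⊕ (⊖ (v ⊗ X) ⊕ u ⊗ (v ⊗ XY))    ≈⟨ interchange F _ _ _ ⟩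
        (F ⊝ v ⊗ X) ⊕ (⊖ (u ⊗ Y) ⊕ u ⊗ (v ⊗ XY))    ≈⟨ +-congˡ (+-comm _ _) ⟩
        (F ⊝ v ⊗ X) ⊕ (u ⊗ (v ⊗ XY) ⊝ u ⊗ Y)        ≈⟨ +-congˡ (⁻¹-anti-homo‿- _ _) ⟨
        (F ⊝ v ⊗ X) ⊕ ⊖ (u ⊗ Y ⊝ u ⊗ (v ⊗ XY))      ≈⟨ +-congˡ (-‿cong (x[y-z]≈xy-xz u Y _)) ⟨
        (F ⊝ v ⊗ X) ⊝ u ⊗ (Y ⊝ v ⊗ XY)              ∎

    ∑-factor : ∀ {A : Set} x (xs : List A) (F : A → Series) n →
               ∑ xs (λ i → factor x (F i) n) ≈ factor x (λ m → ∑ xs (λ i → F i m)) n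
    ∑-factor x xs F n = trans (∑-linear xs _ (c x) _) (+-congˡ (-‿cong (*-congˡ (sym (q^-∑ x xs F n)))))

    factorIf : Bool → ℕ → Series → Series
    factorIf true  x f = factor x f
    factorIf false x f = f

    factorIf-cong : ∀ b x {f g} → f ≋ g → factorIf b x f ≋ factorIf b x g
    factorIf-cong true  x f≋g = factor-cong x f≋g
    factorIf-cong false x f≋g = f≋g

    factorIf-below : ∀ b x f {n} → n < x → factorIf b x f n ≈ f n
    factorIf-below true  x f n<x = factor-below x f n<x
    factorIf-below false x f n<x = refl

    -- ∏ (1 - c x q^x) over the x < M with S x
    prod : (ℕ → Bool) → ℕ → Series
    prod S zero    = one
    prod S (suc M) = factorIf (S M) M (prod S M)

    prod-cong : ∀ {S S′} M → (∀ x → x < M → S x ≡ S′ x) → prod S M ≋ prod S′ M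
    prod-cong zero    S≡S′ = λ _ → refl
    prod-cong {S′ = S′} (suc M) S≡S′ rewrite S≡S′ M (ℕ.n<1+n M) =
      factorIf-cong (S′ M) M (prod-cong M (λ x x<M → S≡S′ x (ℕ.m<n⇒m<1+n x<M)))

    prod-none : ∀ {S} M → (∀ x → x < M → S x ≡ false) → prod S M ≋ one
    prod-none zero    S≡false = λ _ → refl
    prod-none (suc M) S≡false rewrite S≡false M (ℕ.n<1+n M) =
      prod-none M (λ x x<M → S≡false x (ℕ.m<n⇒m<1+n x<M))

    prod-remove : ∀ {S S′ x} M → x < M → S x ≡ true → S′ x ≡ false → (∀ y → y ≢ x → S y ≡ S′ y) →
                  prod S M ≋ factor x (prod S′ M)
    prod-remove {S′ = S′} {x} (suc M) x<1+M Sx S′x S≡S′ with ℕ.m≤n⇒m<n∨m≡n (ℕ.≤-pred x<1+M)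
    ... | inj₂ ≡.refl rewrite Sx | S′x =
      factor-cong x (prod-cong x (λ y y<x → S≡S′ y (ℕ.<⇒≢ y<x)))
    ... | inj₁ x<M rewrite S≡S′ M (ℕ.>⇒≢ x<M) with S′ M
    ...   | true  = λ n → trans (factor-cong M (prod-remove M x<M Sx S′x S≡S′) n)
                                (factor-comm M x (prod S′ M) n)
    ...   | false = prod-remove M x<M Sx S′x S≡S′

    prod∞ : (ℕ → Bool) → Series
    prod∞ S n = prod S (suc n) n

    prod-stable : ∀ S M {n} → n < M → prod S M n ≈ prod∞ S n
    prod-stable S (suc M) {n} n<1+M with ℕ.m≤n⇒m<n∨m≡n (ℕ.≤-pred n<1+M)
    ... | inj₂ ≡.refl = refl
    ... | inj₁ n<M    = trans (factorIf-below (S M) M (prod S M) n<M) (prod-stable S M n<M)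

    prod∞-remove : ∀ {S S′ x} → S x ≡ true → S′ x ≡ false → (∀ y → y ≢ x → S y ≡ S′ y) →
                   prod∞ S ≋ factor x (prod∞ S′)
    prod∞-remove {S} {S′} {x} Sx S′x S≡S′ n = begin
      prod∞ S n                 ≈⟨ prod-stable S N (s≤s (ℕ.m≤m+n n x)) ⟨
      prod S N n                ≈⟨ prod-remove N (s≤s (ℕ.m≤n+m x n)) Sx S′x S≡S′ n ⟩
      factor x (prod S′ N) n    ≈⟨ factor-cong-≤ x n (λ m m≤n → prod-stable S′ N (s≤s (ℕ.≤-trans m≤n (ℕ.m≤m+n n x)))) ⟩
      factor x (prod∞ S′) n     ∎
      where N = suc (n + x)

  module Recurrence (a : Carrier) (H : ℕ → Series)
                    (H-rec : ∀ r n → H r n ⊕ a ⊗ (q^ suc (2 * r) · H (suc r)) n ≈ one n) where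

    H-unfold : ∀ r n → H r n ≈ one n ⊝ a ⊗ (q^ suc (2 * r) · H (suc r)) n
    H-unfold r n = trans (sym (//-rightDividesʳ _ (H r n))) (+-congʳ (H-rec r n))

    H-zero : ∀ r → H r 0 ≈ 1#
    H-zero r = trans (H-unfold r 0) (x⊝y⊗0≈x 1# a)

    H-shift : ∀ r m → H r (suc (2 * r) + m) ≈ ⊖ a ⊗ H (suc r) m
    H-shift r m = begin
      H r (suc (2 * r) + m)                      ≈⟨ H-unfold r _ ⟩
      0# ⊝ a ⊗ (q^ suc (2 * r) · H (suc r)) (suc (2 * r) + m)
        ≈⟨ +-congˡ (-‿cong (*-congˡ (reflexive (q^-+ (suc (2 * r)) (H (suc r)) m)))) ⟩
      0# ⊝ a ⊗ H (suc r) m                       ≈⟨ +-identityˡ _ ⟩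
      ⊖ (a ⊗ H (suc r) m)                        ≈⟨ -‿distribˡ-* a _ ⟩
      ⊖ a ⊗ H (suc r) m                          ∎

    H-square : ∀ k r → H r (k * k + 2 * r * k) ≈ pow R (⊖ a) k
    H-square zero    r rewrite ℕ.*-zeroʳ (2 * r) = H-zero r
    H-square (suc k) r rewrite square-step k r =
      trans (H-shift r _) (*-congˡ (H-square k (suc r)))

    H-nonsquare : ∀ n r → (∀ k → n ≢ k * k + 2 * r * k) → H r n ≈ 0#
    H-nonsquare = <-rec _ step
      where
      step : ∀ n → (∀ {m} → m < n → ∀ r → (∀ k → m ≢ k * k + 2 * r * k) → H r m ≈ 0#) →
             ∀ r → (∀ k → n ≢ k * k + 2 * r * k) → H r n ≈ 0#
      step zero    _  r n≢ = ⊥-elim (n≢ 0 (≡.sym (ℕ.*-zeroʳ (2 * r))))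
      step (suc n) ih r n≢ with suc n <? suc (2 * r)
      ... | yes n<2r+1 = trans (H-unfold r (suc n))
                          (trans (+-congˡ (-‿cong (*-congˡ (reflexive (q^-below (suc (2 * r)) _ n<2r+1)))))
                                 (x⊝y⊗0≈x 0# a))
      ... | no n≮2r+1 with m , ≡.refl ← ℕ.m≤n⇒∃[o]m+o≡n (ℕ.≮⇒≥ n≮2r+1) =
        trans (H-shift r m) (trans (*-congˡ (ih (s≤s (ℕ.m≤n+m m (2 * r))) (suc r) m≢)) (zeroʳ _))
        where
        m≢ : ∀ k → m ≢ k * k + 2 * suc r * k
        m≢ k m≡ = n≢ (suc k) (≡.trans (≡.cong (suc (2 * r) +_) m≡) (≡.sym (square-step k r)))

module Partitions (R : CommutativeRing 0ℓ 0ℓ) (a : CommutativeRing.Carrier R) where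
  open CommutativeRing R renaming (_+_ to _⊕_; _*_ to _⊗_; -_ to ⊖_; _-_ to _⊝_)
  open import Algebra.Properties.Ring ring using (-1*x≈-x; -‿distribˡ-*)
  open import Algebra.Properties.CommutativeSemigroup *-commutativeSemigroup
    using () renaming (x∙yz≈y∙xz to x⊗yz≈y⊗xz)
  open import Algebra.Properties.CommutativeSemigroup +-commutativeSemigroup
    using () renaming (x∙yz≈y∙xz to x⊕yz≈y⊕xz)
  open Series R
  open import Relation.Binary.Reasoning.Setoid setoid

  wt : ℕ → Carrier
  wt x = if even x then 1# else a

  wt-even : ∀ x → even x ≡ true → wt x ≡ 1#
  wt-even _ ex rewrite ex = ≡.refl

  wt-odd : ∀ x → even x ≡ false → wt x ≡ a
  wt-odd _ ox rewrite ox = ≡.refl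

  open Product wt

  above : ℕ → ℕ → ℕ → Bool
  above o e x = if even x then e ≤ᵇ x else o ≤ᵇ x

  P : ℕ → ℕ → Series
  P o e = prod∞ (above o e)

  P-remove-odd : ∀ {o o′} e → even o ≡ false → 2 + o ≡ o′ → P o e ≋ factor o (P o′ e)
  P-remove-odd {o} e odd-o ≡.refl = prod∞-remove present absent agree
    where
    present : above o e o ≡ true
    present rewrite odd-o = ≤ᵇ-true (ℕ.≤-refl {o})
    absent : above (2 + o) e o ≡ false
    absent rewrite odd-o = ≤ᵇ-false (ℕ.m≤n+m (suc o) 1)
    agree : ∀ y → y ≢ o → above o e y ≡ above (2 + o) e y
    agree y y≢o with even y in ey
    ... | true  = ≡.refl
    ... | false = ≡.trans (≤ᵇ-skip o y (y≢o ∘ ≡.sym))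
                          (≤ᵇ-skip (suc o) y (suc≢-of-same-parity o y (≡.trans odd-o (≡.sym ey))))

  P-remove-even : ∀ {e e′} o → even e ≡ true → 2 + e ≡ e′ → P o e ≋ factor e (P o e′)
  P-remove-even {e} o even-e ≡.refl = prod∞-remove present absent agree
    where
    present : above o e e ≡ true
    present rewrite even-e = ≤ᵇ-true (ℕ.≤-refl {e})
    absent : above o (2 + e) e ≡ false
    absent rewrite even-e = ≤ᵇ-false (ℕ.m≤n+m (suc e) 1)
    agree : ∀ y → y ≢ e → above o e y ≡ above o (2 + e) y
    agree y y≢e with even y in ey
    ... | true  = ≡.trans (≤ᵇ-skip e y (y≢e ∘ ≡.sym))
                          (≤ᵇ-skip (suc e) y (suc≢-of-same-parity e y (≡.trans even-e (≡.sym ey))))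
    ... | false = ≡.refl

  P-trivial : ∀ o e {n} → n < o → n < e → P o e n ≈ one n
  P-trivial o e {n} n<o n<e = prod-none (suc n) (λ x x<1+n → absent x (ℕ.≤-pred x<1+n)) n
    where
    absent : ∀ x → x ≤ n → above o e x ≡ false
    absent x x≤n with even x
    ... | true  = ≤ᵇ-false (ℕ.≤-<-trans x≤n n<e)
    ... | false = ≤ᵇ-false (ℕ.≤-<-trans x≤n n<o)

  oddIdx : ℕ → ℕ → ℕ
  oddIdx r j = suc (2 * (r + j))

  -- the first J terms of G r; those with j > n do not reach q^n
  Gpartial : ℕ → ℕ → Series
  Gpartial r J n = ∑ (downFrom J) (λ j → (q^ (2 * j) · P (oddIdx r j) (2 * suc j)) n)

  G : ℕ → Series
  G r n = Gpartial r (suc n) n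

  Gpartial-stable : ∀ r J {n} → n < J → Gpartial r J n ≈ G r n
  Gpartial-stable r J {n} n<J = ∑-downFrom-truncate J _ vanish n<J
    where
    vanish : ∀ j → suc n ≤ j → (q^ (2 * j) · P (oddIdx r j) (2 * suc j)) n ≈ 0#
    vanish j n<j = reflexive (q^-below (2 * j) _ (ℕ.<-≤-trans n<j (ℕ.m≤n*m j 2)))

  module Telescope (r : ℕ) where

    o : ℕ → ℕ
    o = oddIdx r

    p p′ : ℕ → Series
    p  j = P (o j) (2 * suc j)
    p′ j = P (o (suc j)) (2 * suc j)

    o-odd : ∀ j → even (o j) ≡ false
    o-odd j = even-double+1 (r + j)

    o-suc : ∀ j → 2 + o j ≡ o (suc j)
    o-suc j = ≡.cong suc (≡.sym (≡.trans (≡.cong (2 *_) (ℕ.+-suc r j)) (ℕ.*-suc 2 (r + j))))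

    p-remove : ∀ j → p j ≋ factor (o j) (p′ j)
    p-remove j = P-remove-odd _ (o-odd j) (o-suc j)

    p′-remove : ∀ j → p′ j ≋ factor (2 * suc j) (factor (o (suc j)) (p′ (suc j)))
    p′-remove j n = begin
      p′ j n                                                   ≈⟨ P-remove-odd _ (o-odd (suc j)) (o-suc (suc j)) n ⟩
      factor (o (suc j)) (P (o (suc (suc j))) (2 * suc j)) n
        ≈⟨ factor-cong (o (suc j)) (P-remove-even _ (even-double (suc j)) (≡.sym (ℕ.*-suc 2 (suc j)))) n ⟩
      factor (o (suc j)) (factor (2 * suc j) (p′ (suc j))) n   ≈⟨ factor-comm (o (suc j)) (2 * suc j) (p′ (suc j)) n ⟩
      factor (2 * suc j) (factor (o (suc j)) (p′ (suc j))) n   ∎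

    -- the j-th terms of G r and of a q^(2r+1) G (r+1) taken together; they telescope
    t : ℕ → Series
    t j n = (q^ (2 * j) · p j) n ⊕ a ⊗ (q^ (o j) · p′ j) n

    t-zero : ∀ n → t 0 n ≈ p′ 0 n
    t-zero n = trans (+-cong (p-remove 0 n) (*-congʳ (reflexive (≡.sym (wt-odd (o 0) (o-odd 0))))))
                     (factor-complement (o 0) (p′ 0) n)

    t-suc : ∀ j n → t (suc j) n ≈ p′ (suc j) n ⊝ p′ j n
    t-suc j n = begin
      (q^ E · p (suc j)) n ⊕ a ⊗ (q^ O · F) n
        ≈⟨ +-cong (q^-cong E (p-remove (suc j)) n) (*-congʳ (reflexive (≡.sym (wt-odd O (o-odd (suc j)))))) ⟩
      (q^ E · factor O F) n ⊕ wt O ⊗ (q^ O · F) n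
        ≈⟨ +-congʳ (trans (sym (*-identityˡ _)) (*-congʳ (reflexive (≡.sym (wt-even E (even-double (suc j))))))) ⟩
      wt E ⊗ (q^ E · factor O F) n ⊕ wt O ⊗ (q^ O · F) n   ≈⟨ factor²-complement O E F n ⟩
      F n ⊝ factor E (factor O F) n                         ≈⟨ +-congˡ (-‿cong (p′-remove j n)) ⟨
      F n ⊝ p′ j n                                          ∎
      where
      E = 2 * suc j
      O = o (suc j)
      F = p′ (suc j)

  G-rec : ∀ r n → G r n ⊕ a ⊗ (q^ suc (2 * r) · G (suc r)) n ≈ one n
  G-rec r n = begin
    G r n ⊕ a ⊗ (q^ suc (2 * r) · G (suc r)) n
      ≈⟨ +-congˡ (*-congˡ (q^-cong-≤ (suc (2 * r)) n (λ m m≤n → sym (Gpartial-stable (suc r) (suc n) (s≤s m≤n))))) ⟩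
    G r n ⊕ a ⊗ (q^ suc (2 * r) · Gpartial (suc r) (suc n)) n
      ≈⟨ +-congˡ (*-congˡ (q^-∑ (suc (2 * r)) js _ n)) ⟩
    G r n ⊕ a ⊗ ∑ js (λ j → (q^ suc (2 * r) · q^ (2 * j) · P (oddIdx (suc r) j) (2 * suc j)) n)
      ≈⟨ +-congˡ (*-congˡ (∑-cong js (λ j → reflexive (reindex j)))) ⟩
    G r n ⊕ a ⊗ ∑ js (λ j → (q^ o j · p′ j) n)
      ≈⟨ +-congˡ (∑-⊗ js a _) ⟨
    G r n ⊕ ∑ js (λ j → a ⊗ (q^ o j · p′ j) n)
      ≈⟨ ∑-+ js _ _ ⟨
    ∑ js (λ j → t j n)
      ≈⟨ ∑-telescope (λ j → t j n) (λ j → p′ j n) (t-zero n) (λ j → t-suc j n) n ⟩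
    p′ n n
      ≈⟨ P-trivial (o (suc n)) (2 * suc n)
           (ℕ.<-≤-trans (ℕ.m≤n+m (suc n) r) (ℕ.≤-trans (ℕ.m≤n*m (r + suc n) 2) (ℕ.n≤1+n _)))
           (ℕ.<-≤-trans (ℕ.n<1+n n) (ℕ.m≤n*m (suc n) 2)) ⟩
    one n ∎
    where
    open Telescope r
    js = downFrom (suc n)
    reindex : ∀ j → (q^ suc (2 * r) · q^ (2 * j) · P (oddIdx (suc r) j) (2 * suc j)) n ≡ (q^ o j · p′ j) n
    reindex j = ≡.trans (q^-q^ (suc (2 * r)) (2 * j) _ n)
      (≡.cong₂ (λ k o′ → (q^ k · P o′ (2 * suc j)) n)
               (≡.cong suc (≡.sym (ℕ.*-distribˡ-+ 2 r j)))
               (≡.cong (suc ∘ (2 *_)) (≡.sym (ℕ.+-suc r j))))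

  pow-oddParts-cons : ∀ x xs → pow R a (oddParts (x ∷ xs)) ≈ wt x ⊗ pow R a (oddParts xs)
  pow-oddParts-cons x xs rewrite isYes≗does (2 ∣? x) with even x
  ... | true  = sym (*-identityˡ _)
  ... | false = refl

  ωe-cons : ∀ M x xs → ωe R a (M ∷ x ∷ xs) ≈ ⊖ (wt M ⊗ ωe R a (x ∷ xs))
  ωe-cons M x xs = begin
    (⊖ 1# ⊗ S) ⊗ pow R a (oddParts (M ∷ x ∷ xs))  ≈⟨ *-cong (-1*x≈-x S) (pow-oddParts-cons M (x ∷ xs)) ⟩
    ⊖ S ⊗ (wt M ⊗ Y)                               ≈⟨ -‿distribˡ-* S _ ⟨
    ⊖ (S ⊗ (wt M ⊗ Y))                             ≈⟨ -‿cong (x⊗yz≈y⊗xz S (wt M) Y) ⟩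
    ⊖ (wt M ⊗ (S ⊗ Y))                             ∎
    where
    S = pow R (⊖ 1#) (length xs)
    Y = pow R a (oddParts (x ∷ xs))

  weightIfQ : ℕ → List ℕ → Carrier
  weightIfQ n xs = if isQ n xs then ωe R a xs else 0#

  evenPower : ℕ → Series
  evenPower M n = if even M then (q^ M · one) n else 0#

  weightIfQ-singleton : ∀ M n → weightIfQ n (M ∷ []) ≈ evenPower M n
  weightIfQ-singleton M n rewrite ℕ.+-identityʳ M | isYes≗does (2 ∣? M) | q^-one M n
    with M ≡ᵇ n | even M
  ... | true  | true  = *-identityˡ 1#
  ... | false | true  = refl
  ... | true  | false = refl
  ... | false | false = refl

  strictlyDecreasing-cons : ∀ {M x} xs → x < M → strictlyDecreasing (M ∷ x ∷ xs) ≡ strictlyDecreasing (x ∷ xs)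
  strictlyDecreasing-cons {M} {x} xs x<M with M >? x
  ... | yes _   = ≡.trans (isYes≗does _) (≡.sym (isYes≗does _))
  ... | no x≮M = ⊥-elim (x≮M x<M)

  isQ-cons : ∀ {M} x xs n → x < M →
             isQ n (M ∷ x ∷ xs) ≡ strictlyDecreasing (x ∷ xs) ∧ ((M + sum (x ∷ xs) ≡ᵇ n) ∧ lastEven (x ∷ xs))
  isQ-cons {M} x xs n x<M =
    ≡.cong (_∧ ((M + sum (x ∷ xs) ≡ᵇ n) ∧ lastEven (x ∷ xs))) (strictlyDecreasing-cons xs x<M)

  weightIfQ-cons : ∀ {M} n xs → All (_< M) xs →
    weightIfQ n (M ∷ xs) ≈ (if null xs then evenPower M n else 0#) ⊝ wt M ⊗ (q^ M · (λ m → weightIfQ m xs)) n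
  weightIfQ-cons {M} n [] [] =
    trans (weightIfQ-singleton M n) (sym (trans (+-congˡ (-‿cong (*-congˡ (reflexive (q^-zero M n))))) (x⊝y⊗0≈x _ _)))
  weightIfQ-cons {M} n ys@(x ∷ xs) (x<M ∷ _) with n <? M
  ... | yes n<M = begin
    weightIfQ n (M ∷ ys)                      ≡⟨ ≡.cong (λ b → if b then ωe R a (M ∷ ys) else 0#) notQ ⟩
    0#                                        ≈⟨ x⊝y⊗0≈x 0# (wt M) ⟨
    0# ⊝ wt M ⊗ 0#                            ≡⟨ ≡.cong (λ v → 0# ⊝ wt M ⊗ v) (q^-below M _ n<M) ⟨
    0# ⊝ wt M ⊗ (q^ M · (λ m → weightIfQ m ys)) n ∎
    where
    notQ : isQ n (M ∷ ys) ≡ false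
    notQ = ≡.trans (isQ-cons x xs n x<M)
      (≡.trans (≡.cong (λ b → strictlyDecreasing ys ∧ (b ∧ lastEven ys)) (≡ᵇ-below M (sum ys) n<M)) (∧-zeroʳ _))
  ... | no n≮M with m , ≡.refl ← ℕ.m≤n⇒∃[o]m+o≡n (ℕ.≮⇒≥ n≮M) = begin
    weightIfQ (M + m) (M ∷ ys)                ≡⟨ ≡.cong (λ b → if b then ωe R a (M ∷ ys) else 0#) sameQ ⟩
    (if isQ m ys then ωe R a (M ∷ ys) else 0#) ≈⟨ drop-M (isQ m ys) ⟩
    0# ⊝ wt M ⊗ weightIfQ m ys                ≡⟨ ≡.cong (λ v → 0# ⊝ wt M ⊗ v) (q^-+ M _ m) ⟨
    0# ⊝ wt M ⊗ (q^ M · (λ m → weightIfQ m ys)) (M + m) ∎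
    where
    sameQ : isQ (M + m) (M ∷ ys) ≡ isQ m ys
    sameQ = ≡.trans (isQ-cons x xs (M + m) x<M)
      (≡.cong (λ b → strictlyDecreasing ys ∧ (b ∧ lastEven ys)) (≡ᵇ-cancelˡ M (sum ys) m))
    drop-M : ∀ b → (if b then ωe R a (M ∷ ys) else 0#) ≈ 0# ⊝ wt M ⊗ (if b then ωe R a ys else 0#)
    drop-M true  = trans (ωe-cons M x xs) (sym (+-identityˡ _))
    drop-M false = sym (x⊝y⊗0≈x 0# (wt M))

  parts-below : ∀ M → All (All (_< M)) (subsetsDesc M)
  parts-below zero    = [] ∷ []
  parts-below (suc M) = All.++⁺ (All.map (All.map ℕ.m<n⇒m<1+n) (parts-below M))
                                (All.map⁺ (All.map (λ h → ℕ.n<1+n M ∷ All.map ℕ.m<n⇒m<1+n h) (parts-below M)))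

  ∑-subsets-null : ∀ M v → ∑ (subsetsDesc M) (λ xs → if null xs then v else 0#) ≈ v
  ∑-subsets-null zero    v = +-identityʳ v
  ∑-subsets-null (suc M) v = begin
    ∑ (S ++ map (M ∷_) S) f                 ≈⟨ ∑-++ S _ f ⟩
    ∑ S f ⊕ ∑ (map (M ∷_) S) f              ≡⟨ ≡.cong (∑ S f ⊕_) (∑-map (M ∷_) S f) ⟩
    ∑ S f ⊕ ∑ S (λ _ → 0#)                  ≈⟨ +-cong (∑-subsets-null M v) (∑-zero S) ⟩
    v ⊕ 0#                                  ≈⟨ +-identityʳ v ⟩
    v                                       ∎
    where
    S = subsetsDesc M
    f = λ xs → if null xs then v else 0#

  Qsum : ℕ → Series
  Qsum M n = ∑ (subsetsDesc M) (weightIfQ n)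

  Qsum-suc : ∀ M n → Qsum (suc M) n ≈ factor M (Qsum M) n ⊕ evenPower M n
  Qsum-suc M n = begin
    ∑ (S ++ map (M ∷_) S) (weightIfQ n)                         ≈⟨ ∑-++ S _ _ ⟩
    Qsum M n ⊕ ∑ (map (M ∷_) S) (weightIfQ n)                   ≡⟨ ≡.cong (Qsum M n ⊕_) (∑-map (M ∷_) S _) ⟩
    Qsum M n ⊕ ∑ S (λ xs → weightIfQ n (M ∷ xs))
      ≈⟨ +-congˡ (∑-cong-All S (parts-below M) (λ {xs} → weightIfQ-cons n xs)) ⟩
    Qsum M n ⊕ ∑ S (λ xs → (if null xs then evenPower M n else 0#) ⊝ wt M ⊗ (q^ M · (λ m → weightIfQ m xs)) n)
      ≈⟨ +-congˡ (∑-linear S _ (wt M) _) ⟩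
    Qsum M n ⊕ (∑ S (λ xs → if null xs then evenPower M n else 0#) ⊝ wt M ⊗ ∑ S (λ xs → (q^ M · (λ m → weightIfQ m xs)) n))
      ≈⟨ +-congˡ (+-cong (∑-subsets-null M _) (-‿cong (*-congˡ (sym (q^-∑ M S (λ xs m → weightIfQ m xs) n))))) ⟩
    Qsum M n ⊕ (evenPower M n ⊝ wt M ⊗ (q^ M · Qsum M) n)       ≈⟨ x⊕yz≈y⊕xz _ _ _ ⟩
    evenPower M n ⊕ factor M (Qsum M) n                          ≈⟨ +-comm _ _ ⟩
    factor M (Qsum M) n ⊕ evenPower M n                          ∎
    where S = subsetsDesc M

  -- the contribution of the partitions with parts < M and smallest part i
  smallestPart : ℕ → ℕ → Series
  smallestPart M i n = if even i then (q^ i · prod (i <ᵇ_) M) n else 0#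

  Wsum : ℕ → Series
  Wsum M n = ∑ (downFrom M) (λ i → smallestPart M i n)

  smallestPart-new : ∀ M n → smallestPart (suc M) M n ≈ evenPower M n
  smallestPart-new M n with even M
  ... | true  = q^-cong M (prod-none (suc M) (λ x x<1+M → ≤ᵇ-false x<1+M)) n
  ... | false = refl

  smallestPart-old : ∀ {i M} n → i < M → smallestPart (suc M) i n ≈ factor M (smallestPart M i) n
  smallestPart-old {i} {M} n i<M with even i
  ... | true rewrite ≤ᵇ-true i<M = q^-factor i M (prod (i <ᵇ_) M) n
  ... | false = sym (factor-zero M n)

  Wsum-suc : ∀ M n → Wsum (suc M) n ≈ factor M (Wsum M) n ⊕ evenPower M n
  Wsum-suc M n = begin
    smallestPart (suc M) M n ⊕ ∑ (downFrom M) (λ i → smallestPart (suc M) i n)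
      ≈⟨ +-cong (smallestPart-new M n) (∑-downFrom-cong M (λ i i<M → smallestPart-old n i<M)) ⟩
    evenPower M n ⊕ ∑ (downFrom M) (λ i → factor M (smallestPart M i) n)
      ≈⟨ +-congˡ (∑-factor M (downFrom M) (smallestPart M) n) ⟩
    evenPower M n ⊕ factor M (Wsum M) n
      ≈⟨ +-comm _ _ ⟩
    factor M (Wsum M) n ⊕ evenPower M n ∎

  Qsum≋Wsum : ∀ M → Qsum M ≋ Wsum M
  Qsum≋Wsum zero    n = +-identityʳ 0#
  Qsum≋Wsum (suc M) n = begin
    Qsum (suc M) n                       ≈⟨ Qsum-suc M n ⟩
    factor M (Qsum M) n ⊕ evenPower M n  ≈⟨ +-congʳ (factor-cong M (Qsum≋Wsum M) n) ⟩
    factor M (Wsum M) n ⊕ evenPower M n  ≈⟨ Wsum-suc M n ⟨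
    Wsum (suc M) n                       ∎

  above-first-odd : ∀ j x → (2 * j <ᵇ x) ≡ above (suc (2 * j)) (2 * suc j) x
  above-first-odd j x with even x in ex
  ... | true  = ≡.trans (≤ᵇ-skip (suc (2 * j)) x (suc≢-of-same-parity (2 * j) x (≡.trans (even-double j) (≡.sym ex))))
                        (≡.cong (_≤ᵇ x) (≡.sym (ℕ.*-suc 2 j)))
  ... | false = ≡.refl

  Wsum≈G : ∀ n → Wsum (suc n) n ≈ G 0 n
  Wsum≈G n = begin
    ∑ (downFrom (suc n)) f                  ≈⟨ ∑-downFrom-truncate (2 * suc n) f vanish (ℕ.m≤n*m (suc n) 2) ⟨
    ∑ (downFrom (2 * suc n)) f              ≈⟨ ∑-downFrom-evens (suc n) f odd-vanish ⟩
    ∑ (downFrom (suc n)) (λ j → f (2 * j))  ≈⟨ ∑-cong (downFrom (suc n)) even-term ⟩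
    G 0 n                                   ∎
    where
    f = λ i → smallestPart (suc n) i n
    vanish : ∀ i → suc n ≤ i → f i ≈ 0#
    vanish i n<i with even i
    ... | true  = reflexive (q^-below i _ n<i)
    ... | false = refl
    odd-vanish : ∀ j → f (suc (2 * j)) ≈ 0#
    odd-vanish j rewrite even-double+1 j = refl
    even-term : ∀ j → f (2 * j) ≈ (q^ (2 * j) · P (suc (2 * j)) (2 * suc j)) n
    even-term j rewrite even-double j = q^-cong-≤ (2 * j) n (λ m m≤n →
      trans (prod-stable (2 * j <ᵇ_) (suc n) (s≤s m≤n)) (prod-cong (suc m) (λ x _ → above-first-odd j x) m))

  sumQ≈G : ∀ n → sumQ R a n ≈ G 0 n
  sumQ≈G n = begin
    sumQ R a n         ≈⟨ ∑-filter (isQ n) (subsetsDesc (suc n)) (ωe R a) ⟩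
    Qsum (suc n) n     ≈⟨ Qsum≋Wsum (suc n) n ⟩
    Wsum (suc n) n     ≈⟨ Wsum≈G n ⟩
    G 0 n              ∎

theorem6p1 : (R : CommutativeRing 0ℓ 0ℓ) (a : CommutativeRing.Carrier R) (n : ℕ) →
    ((k : ℕ) → n ≡ k * k →
      CommutativeRing._≈_ R (sumQ R a n) (pow R (CommutativeRing.-_ R a) k))
    × (((k : ℕ) → n ≢ k * k) →
      CommutativeRing._≈_ R (sumQ R a n) (CommutativeRing.0# R))
theorem6p1 R a n = square , nonsquare
  where
  open CommutativeRing R using (_≈_; -_; 0#; trans)
  open Partitions R a using (G; G-rec; sumQ≈G)
  open Series.Recurrence R a G G-rec using (H-square; H-nonsquare)

  square : ∀ k → n ≡ k * k → sumQ R a n ≈ pow R (- a) k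
  square k ≡.refl = trans (sumQ≈G n) (≡.subst (λ m → G 0 m ≈ pow R (- a) k) (ℕ.+-identityʳ (k * k)) (H-square k 0))

  nonsquare : (∀ k → n ≢ k * k) → sumQ R a n ≈ 0#
  nonsquare n≢k² = trans (sumQ≈G n) (H-nonsquare n 0 (λ k n≡ → n≢k² k (≡.trans n≡ (ℕ.+-identityʳ (k * k)))))
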